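{- Let $\beta>0$ be real and let $m<m'<m''$ be natural numbers with $m'>2^m$ and $m''>2^{m'}$. Let $w$ be a set of sequences $\bar d=\langle d_\ell:m'\le\ell<m''\rangle$ with each $d_\ell\in\{j/2^{m''}:0\le j\le 2^{m''-m}\}$, such that every $\bar d\in w$ satisfies $\sum_{\ell\in[m',m'')}d_\ell\ge 1/\beta$, and such that $|w|\le \frac{2^{m-2}}{36\beta}$. Then there is a partition $(u_0,u_1)$ of the interval $[m',m'')$ such that for every $\bar d\in w$ and $h\in\{0,1\}$, $$\frac13\le\frac{\sum_{\ell\in u_h}d_\ell}{\sum_{\ell\in[m',m'')}d_\ell}\le\frac23.$$
   Formalization: The parameter β ranges over the positive rationals instead of the positive reals. -}

module Defs where

open import Data.Nat as ℕ using (ℕ; _^_)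
open import Data.Nat.Properties using (m^n≢0)
open import Data.Integer using (+_)
open import Data.Rational as ℚ using (ℚ; 0ℚ; _<_; _+_; _*_; _/_; 1/_; >-nonZero)
open import Data.Bool using (Bool; if_then_else_)
open import Data.Fin using (Fin)
open import Data.Vec using (Vec; lookup)
open import Data.Vec.Functional using (foldr)
open import Relation.Nullary using (does)
open import Data.Bool.Properties using (_≟_)

dyadic : ℕ → ℕ → ℚ
dyadic j k = _/_ (+ j) (2 ^ k) ⦃ m^n≢0 2 k ⦄

inv : (β : ℚ) → 0ℚ < β → ℚ
inv β β>0 = 1/_ β ⦃ >-nonZero β>0 ⦄

-- 2^(m-2) as a rational number (= 2^m / 4, also for m < 2).
pow2m-2 : ℕ → ℚ
pow2m-2 m = (+ (2 ^ m)) / 4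

Σall : ∀ {n} → Vec ℚ n → ℚ
Σall {n} d = foldr _+_ 0ℚ (lookup d)

-- Sum of the entries with index in u_h = { i | u i ≡ h }, for a
-- partition of the index set given by its indicator u : Fin n → Bool.
Σpart : ∀ {n} → (Fin n → Bool) → Bool → Vec ℚ n → ℚ
Σpart {n} u h d = foldr _+_ 0ℚ (λ i → if does (u i ≟ h) then lookup d i else 0ℚ)

{-# OPTIONS --safe #-}
-- Weight each d ∈ w by 1/Σd and give a partition (u₀, u₁) the potential Σ_d (Σ_{u₀} d − Σ_{u₁} d)² / Σd.
-- Its mean over all partitions is Σ_d Σ_ℓ d_ℓ² / Σd ≤ |w|·2⁻ᵐ, because every entry is at most 2⁻ᵐ.
-- Placing the indices one at a time on the side that does not increase the conditional mean
-- (the method of conditional expectations) gives a partition whose potential is at most |w|·2⁻ᵐ,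
-- which the bound on |w| makes at most Σd/9 for every d. As the d-th term is at most the whole,
-- (Σ_{u₀} d − Σ_{u₁} d)² ≤ (Σd)²/9, so each side carries between a third and two thirds of Σd.
module Submission where

open import Algebra.Bundles using (Ring)
open import Data.Bool using (Bool; true; false; if_then_else_)
open import Data.Bool.Properties using (_≟_)
open import Data.Empty using (⊥-elim)
open import Data.Fin using (Fin; zero; suc; punchIn)
open import Data.Integer using (+_)
import Data.Integer as ℤ
import Data.Integer.Properties as ℤ
open import Data.List as List using (List; length)
open import Data.List.Membership.Propositional.Properties using (∈-lookup)
open import Data.List.Relation.Unary.All as All using (All)
open import Data.List.Relation.Unary.Any using (index)
open import Data.List.Relation.Unary.Any.Properties using (lookup-index)
open import Data.List.Relation.Unary.Unique.Propositional using (Unique)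
open import Data.Nat as ℕ using (ℕ; _^_; _∸_; zero; suc)
import Data.Nat.Properties as ℕ
open import Data.Product using (Σ; _×_; _,_; proj₁; proj₂; ∃-syntax)
open import Data.Rational as ℚ
  using (ℚ; 0ℚ; 1ℚ; _≤_; _<_; _+_; _*_; -_; _-_; _/_; 1/_; positive; nonNegative; nonPositive; toℚᵘ)
open import Data.Rational.Properties hiding (_≟_)
open import Data.Rational.Solver using (module +-*-Solver)
import Data.Rational.Unnormalised as ℚᵘ
import Data.Rational.Unnormalised.Properties as ℚᵘ
open import Data.Sum using (inj₁; inj₂)
open import Data.Vec using (Vec; []; _∷_; lookup)
open import Data.Vec.Functional as Vector using (Vector; head; tail)
open import Function using (_∘_)
open import Relation.Binary.PropositionalEquality
open import Relation.Nullary using (yes; no; does)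

open import Defs
open import Algebra.Properties.Semiring.Sum (Ring.semiring +-*-ring)
  using (sum; sum-cong-≗; sum-remove; sum-replicate-zero; ∑-distrib-+; *-distribˡ-sum)
open +-*-Solver

toℚᵘ-/ : ∀ a b .{{_ : ℕ.NonZero b}} → toℚᵘ (+ a / b) ℚᵘ.≃ ℚᵘ.mkℚᵘ (+ a) (ℕ.pred b)
toℚᵘ-/ a (suc b) = toℚᵘ-fromℚᵘ (ℚᵘ.mkℚᵘ (+ a) b)

/-≤-/ : ∀ {a b c d} .{{_ : ℕ.NonZero b}} .{{_ : ℕ.NonZero d}} →
  a ℕ.* d ℕ.≤ c ℕ.* b → + a / b ≤ + c / d
/-≤-/ {a} {b@(suc _)} {c} {d@(suc _)} ad≤cb = toℚᵘ-cancel-≤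
  (ℚᵘ.≤-respˡ-≃ (ℚᵘ.≃-sym (toℚᵘ-/ a b)) (ℚᵘ.≤-respʳ-≃ (ℚᵘ.≃-sym (toℚᵘ-/ c d))
    (ℚᵘ.*≤* (subst₂ ℤ._≤_ (ℤ.pos-* a d) (ℤ.pos-* c b) (ℤ.+≤+ ad≤cb)))))

/-≡-/ : ∀ {a b c d} .{{_ : ℕ.NonZero b}} .{{_ : ℕ.NonZero d}} →
  a ℕ.* d ≡ c ℕ.* b → + a / b ≡ + c / d
/-≡-/ {a} {b} {c} {d} ad≡cb = ≤-antisym
  (/-≤-/ {a} {b} {c} {d} (ℕ.≤-reflexive ad≡cb))
  (/-≤-/ {c} {d} {a} {b} (ℕ.≤-reflexive (sym ad≡cb)))

/-*-/ : ∀ a b c d .{{_ : ℕ.NonZero b}} .{{_ : ℕ.NonZero d}} →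
  (+ a / b) * (+ c / d) ≡ (+ (a ℕ.* c) / (b ℕ.* d)) {{ℕ.m*n≢0 b d}}
/-*-/ a b@(suc _) c d@(suc _) = toℚᵘ-injective (ℚᵘ.≃-trans (toℚᵘ-homo-* (+ a / b) (+ c / d))
  (ℚᵘ.≃-trans (ℚᵘ.*-cong (toℚᵘ-/ a b) (toℚᵘ-/ c d))
    (ℚᵘ.≃-trans (ℚᵘ.*≡* (cong (ℤ._* (+ (b ℕ.* d))) (sym (ℤ.pos-* a c))))
      (ℚᵘ.≃-sym (toℚᵘ-/ (a ℕ.* c) (b ℕ.* d) {{ℕ.m*n≢0 b d}})))))

suc/1 : ∀ n → + suc n / 1 ≡ 1ℚ + + n / 1
suc/1 n = toℚᵘ-injective (ℚᵘ.≃-trans (toℚᵘ-/ (suc n) 1)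
  (ℚᵘ.≃-trans (ℚᵘ.*≡* (cong (λ z → (+ 1 ℤ.+ z) ℤ.* + 1) (sym (ℤ.*-identityʳ (+ n)))))
    (ℚᵘ.≃-sym (ℚᵘ.≃-trans (toℚᵘ-homo-+ 1ℚ (+ n / 1))
      (ℚᵘ.+-cong (ℚᵘ.≃-refl {toℚᵘ 1ℚ}) (toℚᵘ-/ n 1))))))

square-nonNeg : ∀ x → 0ℚ ≤ x * x
square-nonNeg x with ≤-total 0ℚ x
... | inj₁ 0≤x = ≤-trans (≤-reflexive (sym (*-zeroʳ x))) (*-monoˡ-≤-nonNeg x {{nonNegative 0≤x}} 0≤x)
... | inj₂ x≤0 = ≤-trans (≤-reflexive (sym (*-zeroʳ x))) (*-monoˡ-≤-nonPos x {{nonPositive x≤0}} x≤0)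

square-≤⇒≤ : ∀ {x y} → 0ℚ ≤ y → x * x ≤ y * y → x ≤ y
square-≤⇒≤ {x} {y} 0≤y x²≤y² with x ≤? y
... | yes x≤y = x≤y
... | no  x≰y = ⊥-elim (<-irrefl refl (≤-<-trans x²≤y² y²<x²))
  where
  y<x = ≰⇒> x≰y
  y²<x² : y * y < x * x
  y²<x² = ≤-<-trans (*-monoʳ-≤-nonNeg y {{nonNegative 0≤y}} (<⇒≤ y<x))
                    (*-monoʳ-<-pos x {{positive (≤-<-trans 0≤y y<x)}} y<x)

≤-from-multiple : ∀ {x y p q} k → 0ℚ ≤ k → p ≤ q → y - x ≡ k * (q - p) → x ≤ y
≤-from-multiple {x} {y} {p} {q} k 0≤k p≤q y-x≡k[q-p] = begin
  x                  ≡⟨ +-identityʳ x ⟨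
  x + 0ℚ             ≡⟨ cong (λ r → x + r) (*-zeroʳ k) ⟨
  x + k * 0ℚ         ≡⟨ cong (λ r → x + k * r) (+-inverseʳ p) ⟨
  x + k * (p - p)    ≤⟨ +-monoʳ-≤ x (*-monoˡ-≤-nonNeg k {{nonNegative 0≤k}} (+-monoˡ-≤ (- p) p≤q)) ⟩
  x + k * (q - p)    ≡⟨ cong (λ r → x + r) y-x≡k[q-p] ⟨
  x + (y - x)        ≡⟨ solve 2 (λ x y → x :+ (y :- x) := y) refl x y ⟩
  y                  ∎
  where open ≤-Reasoning

sum-mono-≤ : ∀ {n} {f g : Vector ℚ n} → (∀ i → f i ≤ g i) → sum f ≤ sum g
sum-mono-≤ {zero}  f≤g = ≤-refl
sum-mono-≤ {suc n} f≤g = +-mono-≤ (f≤g zero) (sum-mono-≤ (f≤g ∘ suc))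

sum-nonNeg : ∀ {n} {f : Vector ℚ n} → (∀ i → 0ℚ ≤ f i) → 0ℚ ≤ sum f
sum-nonNeg {n} 0≤f = ≤-trans (≤-reflexive (sym (sum-replicate-zero n))) (sum-mono-≤ 0≤f)

≤-sum : ∀ {n} {f : Vector ℚ n} → (∀ i → 0ℚ ≤ f i) → ∀ i → f i ≤ sum f
≤-sum {suc n} {f} 0≤f i = begin
  f i                                 ≡⟨ +-identityʳ (f i) ⟨
  f i + 0ℚ                            ≤⟨ +-monoʳ-≤ (f i) (sum-nonNeg (0≤f ∘ punchIn i)) ⟩
  f i + sum (Vector.removeAt f i)     ≡⟨ sum-remove f ⟨
  sum f                               ∎
  where open ≤-Reasoning

∑-const : ∀ k p → sum (λ (_ : Fin k) → p) ≡ (+ k / 1) * p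
∑-const zero    p = sym (*-zeroˡ p)
∑-const (suc k) p = begin
  p + sum (λ (_ : Fin k) → p)  ≡⟨ cong (λ r → p + r) (∑-const k p) ⟩
  p + (+ k / 1) * p            ≡⟨ cong (λ r → r + (+ k / 1) * p) (*-identityˡ p) ⟨
  1ℚ * p + (+ k / 1) * p       ≡⟨ *-distribʳ-+ p 1ℚ (+ k / 1) ⟨
  (1ℚ + + k / 1) * p           ≡⟨ cong (_* p) (suc/1 k) ⟨
  (+ suc k / 1) * p            ∎
  where open ≡-Reasoning

sum-squares-≤ : ∀ {n} {v : Vector ℚ n} {M} → (∀ i → 0ℚ ≤ v i × v i ≤ M) →
  sum (λ i → v i * v i) ≤ M * sum v
sum-squares-≤ {v = v} {M} bounded = begin
  sum (λ i → v i * v i)  ≤⟨ sum-mono-≤ vᵢ²≤Mvᵢ ⟩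
  sum (λ i → M * v i)    ≡⟨ *-distribˡ-sum M v ⟨
  M * sum v              ∎
  where
  open ≤-Reasoning
  vᵢ²≤Mvᵢ : ∀ i → v i * v i ≤ M * v i
  vᵢ²≤Mvᵢ i = *-monoʳ-≤-nonNeg (v i) {{nonNegative (proj₁ (bounded i))}} (proj₂ (bounded i))

sign : Bool → ℚ
sign true  = 1ℚ
sign false = - 1ℚ

signedSum : ∀ {n} → Vector Bool n → Vector ℚ n → ℚ
signedSum u v = sum (λ i → sign (u i) * v i)

opposing-sign : ∀ t → ∃[ s ] sign s * t ≤ 0ℚ
opposing-sign t with t ≤? 0ℚ
... | yes t≤0 = true  , ≤-trans (≤-reflexive (*-identityˡ t)) t≤0
... | no  t≰0 = false , *-monoˡ-≤-nonPos (- 1ℚ) (<⇒≤ (≰⇒> t≰0))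

weighted-signed-square : ∀ s c x d →
  c * ((sign s * x + d) * (sign s * x + d)) ≡
  c * (x * x) + c * (d * d) + sign s * (c * (x * d) + c * (x * d))
weighted-signed-square true  = solve 3 (λ c x d →
  c :* ((con 1ℚ :* x :+ d) :* (con 1ℚ :* x :+ d)) :=
  c :* (x :* x) :+ c :* (d :* d) :+ con 1ℚ :* (c :* (x :* d) :+ c :* (x :* d))) refl
weighted-signed-square false = solve 3 (λ c x d →
  c :* ((con (- 1ℚ) :* x :+ d) :* (con (- 1ℚ) :* x :+ d)) :=
  c :* (x :* x) :+ c :* (d :* d) :+ con (- 1ℚ) :* (c :* (x :* d) :+ c :* (x :* d))) refl

potential : ∀ {k n} → Vector ℚ k → (Fin k → Vector ℚ n) → Vector Bool n → ℚ
potential c v u = sum (λ j → c j * (signedSum u (v j) * signedSum u (v j)))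

meanPotential : ∀ {k n} → Vector ℚ k → (Fin k → Vector ℚ n) → ℚ
meanPotential c v = sum (λ j → c j * sum (λ i → v j i * v j i))

extend-signs : ∀ {k n} (c : Vector ℚ k) (v : Fin k → Vector ℚ (suc n)) (u : Vector Bool n) →
  ∃[ s ] potential c v (s Vector.∷ u) ≤
         sum (λ j → c j * (head (v j) * head (v j))) + potential c (tail ∘ v) u
extend-signs {k} c v u = let s , s·cross≤0 = opposing-sign (sum cross) in s , bound s s·cross≤0
  where
  x d cross new old : Vector ℚ k
  x j = head (v j)
  d j = signedSum u (tail (v j))
  cross j = c j * (x j * d j) + c j * (x j * d j)
  new j = c j * (x j * x j)
  old j = c j * (d j * d j)
  bound : ∀ s → sign s * sum cross ≤ 0ℚ → potential c v (s Vector.∷ u) ≤ sum new + sum old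
  bound s s·cross≤0 = begin
    potential c v (s Vector.∷ u)
      ≡⟨ sum-cong-≗ (λ j → weighted-signed-square s (c j) (x j) (d j)) ⟩
    sum (λ j → new j + old j + sign s * cross j)
      ≡⟨ ∑-distrib-+ (λ j → new j + old j) (λ j → sign s * cross j) ⟩
    sum (λ j → new j + old j) + sum (λ j → sign s * cross j)
      ≡⟨ cong₂ _+_ (∑-distrib-+ new old) (sym (*-distribˡ-sum (sign s) cross)) ⟩
    sum new + sum old + sign s * sum cross
      ≤⟨ +-monoʳ-≤ (sum new + sum old) s·cross≤0 ⟩
    sum new + sum old + 0ℚ
      ≡⟨ +-identityʳ (sum new + sum old) ⟩
    sum new + sum old ∎
    where open ≤-Reasoning

meanPotential-head-tail : ∀ {k n} (c : Vector ℚ k) (v : Fin k → Vector ℚ (suc n)) →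
  meanPotential c v ≡ sum (λ j → c j * (head (v j) * head (v j))) + meanPotential c (tail ∘ v)
meanPotential-head-tail {k} c v = trans
  (sum-cong-≗ (λ j → *-distribˡ-+ (c j) (x² j) (tail² j)))
  (∑-distrib-+ (λ j → c j * x² j) (λ j → c j * tail² j))
  where
  x² tail² : Vector ℚ k
  x² j = head (v j) * head (v j)
  tail² j = sum (λ i → tail (v j) i * tail (v j) i)

balancing-signs : ∀ {k} n (c : Vector ℚ k) (v : Fin k → Vector ℚ n) →
  ∃[ u ] potential c v u ≤ meanPotential c v
balancing-signs zero    c v = (λ ()) , ≤-refl
balancing-signs (suc n) c v with balancing-signs n c (tail ∘ v)
... | u , ih with extend-signs c v u
... | s , step = s Vector.∷ u , (begin
  potential c v (s Vector.∷ u)        ≤⟨ step ⟩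
  head² + potential c (tail ∘ v) u    ≤⟨ +-monoʳ-≤ head² ih ⟩
  head² + meanPotential c (tail ∘ v)  ≡⟨ meanPotential-head-tail c v ⟨
  meanPotential c v                   ∎)
  where
  open ≤-Reasoning
  head² : ℚ
  head² = sum (λ j → c j * (head (v j) * head (v j)))

Σpart-true+false : ∀ {n} (u : Vector Bool n) (d : Vec ℚ n) → Σpart u true d + Σpart u false d ≡ Σall d
Σpart-true+false u d = trans (sym (∑-distrib-+ (part true) (part false))) (sum-cong-≗ split)
  where
  part : Bool → Vector ℚ _
  part h i = if does (u i ≟ h) then lookup d i else 0ℚ
  split : ∀ i → part true i + part false i ≡ lookup d i
  split i with u i
  ... | true  = +-identityʳ (lookup d i)
  ... | false = +-identityˡ (lookup d i)

Σpart-true-false : ∀ {n} (u : Vector Bool n) (d : Vec ℚ n) →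
  Σpart u true d - Σpart u false d ≡ signedSum u (lookup d)
Σpart-true-false u []      = refl
Σpart-true-false u (x ∷ d) with u zero | Σpart-true-false (tail u) d
... | true  | ih = trans
  (solve 3 (λ x a b → (x :+ a) :- (con 0ℚ :+ b) := con 1ℚ :* x :+ (a :- b)) refl
    x (Σpart (tail u) true d) (Σpart (tail u) false d))
  (cong (λ r → 1ℚ * x + r) ih)
... | false | ih = trans
  (solve 3 (λ x a b → (con 0ℚ :+ a) :- (x :+ b) := con (- 1ℚ) :* x :+ (a :- b)) refl
    x (Σpart (tail u) true d) (Σpart (tail u) false d))
  (cong (λ r → - 1ℚ * x + r) ih)

MiddleThird : ℚ → ℚ → Set
MiddleThird S P = ((+ 1) / 3) * S ≤ P × P ≤ ((+ 2) / 3) * S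

middle-thirds : ∀ a b → 0ℚ ≤ a + b →
  (+ 3 / 1 * (a - b)) * (+ 3 / 1 * (a - b)) ≤ (a + b) * (a + b) →
  MiddleThird (a + b) a × MiddleThird (a + b) b
middle-thirds a b 0≤a+b 9D²≤S² =
  ( ≤-from-multiple ⅙ 0≤⅙ lower
      (solve 2 (λ a b → a :- con (+ 1 / 3) :* (a :+ b) :=
                        con ⅙ :* ((a :+ b) :- (:- (con (+ 3 / 1) :* (a :- b))))) refl a b)
  , ≤-from-multiple ⅙ 0≤⅙ upper
      (solve 2 (λ a b → con (+ 2 / 3) :* (a :+ b) :- a :=
                        con ⅙ :* ((a :+ b) :- con (+ 3 / 1) :* (a :- b))) refl a b) )
  , ( ≤-from-multiple ⅙ 0≤⅙ upper
      (solve 2 (λ a b → b :- con (+ 1 / 3) :* (a :+ b) :=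
                        con ⅙ :* ((a :+ b) :- con (+ 3 / 1) :* (a :- b))) refl a b)
  , ≤-from-multiple ⅙ 0≤⅙ lower
      (solve 2 (λ a b → con (+ 2 / 3) :* (a :+ b) :- b :=
                        con ⅙ :* ((a :+ b) :- (:- (con (+ 3 / 1) :* (a :- b))))) refl a b) )
  where
  ⅙ = + 1 / 6
  0≤⅙ = nonNegative⁻¹ ⅙
  upper : + 3 / 1 * (a - b) ≤ a + b
  upper = square-≤⇒≤ 0≤a+b 9D²≤S²
  lower : - (+ 3 / 1 * (a - b)) ≤ a + b
  lower = square-≤⇒≤ 0≤a+b (≤-trans (≤-reflexive (square-neg (+ 3 / 1 * (a - b)))) 9D²≤S²)
    where
    square-neg : ∀ x → - x * - x ≡ x * x
    square-neg = solve 1 (λ x → (:- x) :* (:- x) := x :* x) refl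

middle-thirds-of-small-discrepancy : ∀ {n} (u : Vector Bool n) (d : Vec ℚ n) → 0ℚ ≤ Σall d →
  (+ 3 / 1 * signedSum u (lookup d)) * (+ 3 / 1 * signedSum u (lookup d)) ≤ Σall d * Σall d →
  ∀ h → MiddleThird (Σall d) (Σpart u h d)
middle-thirds-of-small-discrepancy u d 0≤S 9D²≤S² =
  subst (λ S → ∀ h → MiddleThird S (Σpart u h d)) (Σpart-true+false u d) by-parts
  where
  a = Σpart u true d
  b = Σpart u false d
  thirds : MiddleThird (a + b) a × MiddleThird (a + b) b
  thirds = middle-thirds a b
    (subst (0ℚ ≤_) (sym (Σpart-true+false u d)) 0≤S)
    (subst₂ (λ D S → (+ 3 / 1 * D) * (+ 3 / 1 * D) ≤ S * S)
      (sym (Σpart-true-false u d)) (sym (Σpart-true+false u d)) 9D²≤S²)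
  by-parts : ∀ h → MiddleThird (a + b) (Σpart u h d)
  by-parts true  = proj₁ thirds
  by-parts false = proj₂ thirds

weighted-square≤potential : ∀ {k n} (c : Vector ℚ k) (v : Fin k → Vector ℚ n) u → (∀ j → 0ℚ ≤ c j) →
  ∀ j → c j * (signedSum u (v j) * signedSum u (v j)) ≤ potential c v u
weighted-square≤potential c v u 0≤c = ≤-sum λ j → let D = signedSum u (v j) in
  nonNegative⁻¹ _ {{nonNeg*nonNeg⇒nonNeg (c j) {{nonNegative (0≤c j)}}
                                         (D * D) {{nonNegative (square-nonNeg D)}}}}

normalised-meanPotential-≤ : ∀ {k n M} (c : Vector ℚ k) (v : Fin k → Vector ℚ n) →
  (∀ j → 0ℚ ≤ c j) → (∀ j → sum (v j) * c j ≡ 1ℚ) → (∀ j i → 0ℚ ≤ v j i × v j i ≤ M) →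
  meanPotential c v ≤ (+ k / 1) * M
normalised-meanPotential-≤ {k} {M = M} c v 0≤c S*c≡1 bounded = begin
  meanPotential c v        ≤⟨ sum-mono-≤ weighted≤M ⟩
  sum (λ (_ : Fin k) → M)  ≡⟨ ∑-const k M ⟩
  (+ k / 1) * M            ∎
  where
  open ≤-Reasoning
  weighted≤M : ∀ j → c j * sum (λ i → v j i * v j i) ≤ M
  weighted≤M j = begin
    c j * sum (λ i → v j i * v j i)
      ≤⟨ *-monoˡ-≤-nonNeg (c j) {{nonNegative (0≤c j)}} (sum-squares-≤ (bounded j)) ⟩
    c j * (M * sum (v j))
      ≡⟨ solve 3 (λ c m s → c :* (m :* s) := m :* (s :* c)) refl (c j) M (sum (v j)) ⟩
    M * (sum (v j) * c j)
      ≡⟨ cong (M *_) (S*c≡1 j) ⟩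
    M * 1ℚ
      ≡⟨ *-identityʳ M ⟩
    M ∎

small-discrepancy : ∀ {S c D K} → 0ℚ ≤ S → S * c ≡ 1ℚ → c * (D * D) ≤ K → + 9 / 1 * K ≤ S →
  (+ 3 / 1 * D) * (+ 3 / 1 * D) ≤ S * S
small-discrepancy {S} {c} {D} {K} 0≤S S*c≡1 cD²≤K 9K≤S = begin
  (+ 3 / 1 * D) * (+ 3 / 1 * D)
    ≡⟨ solve 1 (λ x → (con (+ 3 / 1) :* x) :* (con (+ 3 / 1) :* x) := con (+ 9 / 1) :* (con 1ℚ :* (x :* x))) refl D ⟩
  + 9 / 1 * (1ℚ * (D * D))
    ≡⟨ cong (λ r → + 9 / 1 * (r * (D * D))) S*c≡1 ⟨
  + 9 / 1 * (S * c * (D * D))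
    ≡⟨ solve 4 (λ n s c e → n :* (s :* c :* e) := s :* (n :* (c :* e))) refl (+ 9 / 1) S c (D * D) ⟩
  S * (+ 9 / 1 * (c * (D * D)))
    ≤⟨ *-monoˡ-≤-nonNeg S {{nonNegative 0≤S}} (*-monoˡ-≤-nonNeg (+ 9 / 1) cD²≤K) ⟩
  S * (+ 9 / 1 * K)
    ≤⟨ *-monoˡ-≤-nonNeg S {{nonNegative 0≤S}} 9K≤S ⟩
  S * S ∎
  where open ≤-Reasoning

balanced-partition : ∀ {k n} (d : Fin k → Vec ℚ n) (M : ℚ) →
  (∀ j i → 0ℚ ≤ lookup (d j) i × lookup (d j) i ≤ M) →
  (∀ j → 0ℚ < Σall (d j)) →
  (∀ j → + 9 / 1 * ((+ k / 1) * M) ≤ Σall (d j)) →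
  ∃[ u ] ∀ j h → MiddleThird (Σall (d j)) (Σpart u h (d j))
balanced-partition {k} {n} d M bounded 0<S large = u , λ j →
  middle-thirds-of-small-discrepancy u (d j) (<⇒≤ (0<S j))
    (small-discrepancy {D = signedSum u (v j)} (<⇒≤ (0<S j)) (S*c≡1 j)
      (≤-trans (weighted-square≤potential c v u 0≤c j) potential≤K) (large j))
  where
  S : Vector ℚ k
  S j = Σall (d j)
  instance
    S≢0 : ∀ {j} → ℚ.NonZero (S j)
    S≢0 {j} = pos⇒nonZero (S j) {{positive (0<S j)}}
  c : Vector ℚ k
  c j = 1/ S j
  S*c≡1 : ∀ j → S j * c j ≡ 1ℚ
  S*c≡1 j = *-inverseʳ (S j)
  0≤c : ∀ j → 0ℚ ≤ c j
  0≤c j = <⇒≤ (positive⁻¹ (c j) {{1/pos⇒pos (S j) {{positive (0<S j)}}}})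
  v : Fin k → Vector ℚ n
  v j = lookup (d j)
  u : Vector Bool n
  u = proj₁ (balancing-signs n c v)
  potential≤K : potential c v u ≤ (+ k / 1) * M
  potential≤K = ≤-trans (proj₂ (balancing-signs n c v))
                        (normalised-meanPotential-≤ c v 0≤c S*c≡1 bounded)

0≤dyadic : ∀ j k → 0ℚ ≤ dyadic j k
0≤dyadic j k = /-≤-/ {0} {1} {j} {2 ^ k} {{_}} {{ℕ.m^n≢0 2 k}} ℕ.z≤n

dyadic≤dyadic1 : ∀ {j m k} → m ℕ.≤ k → j ℕ.≤ 2 ^ (k ∸ m) → dyadic j k ≤ dyadic 1 m
dyadic≤dyadic1 {j} {m} {k} m≤k j≤2^[k∸m] =
  /-≤-/ {j} {2 ^ k} {1} {2 ^ m} {{ℕ.m^n≢0 2 k}} {{ℕ.m^n≢0 2 m}} (begin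
    j ℕ.* 2 ^ m              ≤⟨ ℕ.*-monoˡ-≤ (2 ^ m) j≤2^[k∸m] ⟩
    2 ^ (k ∸ m) ℕ.* 2 ^ m    ≡⟨ ℕ.^-distribˡ-+-* 2 (k ∸ m) m ⟨
    2 ^ (k ∸ m ℕ.+ m)        ≡⟨ cong (2 ^_) (ℕ.m∸n+n≡m m≤k) ⟩
    2 ^ k                    ≡⟨ ℕ.*-identityˡ (2 ^ k) ⟨
    1 ℕ.* 2 ^ k              ∎)
  where open ℕ.≤-Reasoning

pow2m-2*dyadic1 : ∀ m → pow2m-2 m * dyadic 1 m ≡ + 1 / 4
pow2m-2*dyadic1 m = trans (/-*-/ (2 ^ m) 4 1 (2 ^ m) {{_}} {{2^m≢0}})
  (/-≡-/ {2 ^ m ℕ.* 1} {4 ℕ.* 2 ^ m} {1} {4} {{ℕ.m*n≢0 4 (2 ^ m) {{_}} {{2^m≢0}}}} (begin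
  2 ^ m ℕ.* 1 ℕ.* 4  ≡⟨ cong (ℕ._* 4) (ℕ.*-identityʳ (2 ^ m)) ⟩
  2 ^ m ℕ.* 4        ≡⟨ ℕ.*-comm (2 ^ m) 4 ⟩
  4 ℕ.* 2 ^ m        ≡⟨ ℕ.*-identityˡ (4 ℕ.* 2 ^ m) ⟨
  1 ℕ.* (4 ℕ.* 2 ^ m) ∎))
  where
  open ≡-Reasoning
  2^m≢0 = ℕ.m^n≢0 2 m

size-bound : ∀ {k m I} → 0ℚ ≤ I → + k / 1 ≤ pow2m-2 m * (+ 1 / 36) * I →
  + 9 / 1 * ((+ k / 1) * dyadic 1 m) ≤ I
size-bound {k} {m} {I} 0≤I k≤P/36·I = begin
  + 9 / 1 * ((+ k / 1) * M)
    ≤⟨ *-monoˡ-≤-nonNeg (+ 9 / 1) (*-monoʳ-≤-nonNeg M {{nonNegative (0≤dyadic 1 m)}} k≤P/36·I) ⟩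
  + 9 / 1 * (pow2m-2 m * (+ 1 / 36) * I * M)
    ≡⟨ solve 4 (λ p c i x → con (+ 9 / 1) :* (p :* c :* i :* x) := con (+ 9 / 1) :* c :* (p :* x) :* i) refl
               (pow2m-2 m) (+ 1 / 36) I M ⟩
  + 9 / 1 * (+ 1 / 36) * (pow2m-2 m * M) * I
    ≡⟨ cong (λ r → + 9 / 1 * (+ 1 / 36) * r * I) (pow2m-2*dyadic1 m) ⟩
  + 1 / 16 * I
    ≤⟨ *-monoʳ-≤-nonNeg I {{nonNegative 0≤I}} (≤ᵇ⇒≤ {+ 1 / 16} {1ℚ} _) ⟩
  1ℚ * I
    ≡⟨ *-identityˡ I ⟩
  I ∎
  where
  open ≤-Reasoning
  M = dyadic 1 m

lemma4p2 : (β : ℚ) → (β>0 : 0ℚ < β) → (m m′ m″ : ℕ) → m ℕ.< m′ → m′ ℕ.< m″ →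
    2 ^ m ℕ.< m′ → 2 ^ m′ ℕ.< m″ →
    (w : List (Vec ℚ (m″ ∸ m′))) → Unique w →
    All (λ d → (i : Fin (m″ ∸ m′)) → Σ ℕ (λ j → (j ℕ.≤ 2 ^ (m″ ∸ m)) × (lookup d i ≡ dyadic j m″))) w →
    All (λ d → inv β β>0 ≤ Σall d) w →
    (+ length w) / 1 ≤ pow2m-2 m * ((+ 1) / 36) * inv β β>0 →
    Σ (Fin (m″ ∸ m′) → Bool) (λ u → All (λ d → (h : Bool) →
      ((+ 1) / 3) * Σall d ≤ Σpart u h d × Σpart u h d ≤ ((+ 2) / 3) * Σall d) w)
lemma4p2 β β>0 m m′ m″ m<m′ m′<m″ _ _ w _ dyadic-entries large small-w =
  u , All.tabulate λ d∈w →
    subst (λ d → ∀ h → MiddleThird (Σall d) (Σpart u h d)) (sym (lookup-index d∈w)) (balanced (index d∈w))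
  where
  I = inv β β>0
  0<I : 0ℚ < I
  0<I = positive⁻¹ I {{1/pos⇒pos β {{positive β>0}}}}
  at : ∀ {P : Vec ℚ (m″ ∸ m′) → Set} → All P w → ∀ j → P (List.lookup w j)
  at ps j = All.lookup ps (∈-lookup j)
  bounded : ∀ j i → 0ℚ ≤ lookup (List.lookup w j) i × lookup (List.lookup w j) i ≤ dyadic 1 m
  bounded j i = let k , k≤2^[m″∸m] , eq = at dyadic-entries j i in
    subst (λ x → 0ℚ ≤ x × x ≤ dyadic 1 m) (sym eq)
      (0≤dyadic k m″ , dyadic≤dyadic1 (ℕ.<⇒≤ (ℕ.<-trans m<m′ m′<m″)) k≤2^[m″∸m])
  0<Σ : ∀ j → 0ℚ < Σall (List.lookup w j)
  0<Σ j = <-≤-trans 0<I (at large j)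
  9K≤Σ : ∀ j → + 9 / 1 * ((+ length w / 1) * dyadic 1 m) ≤ Σall (List.lookup w j)
  9K≤Σ j = ≤-trans (size-bound {length w} {m} (<⇒≤ 0<I) small-w) (at large j)
  partition = balanced-partition (List.lookup w) (dyadic 1 m) bounded 0<Σ 9K≤Σ
  u : Fin (m″ ∸ m′) → Bool
  u = proj₁ partition
  balanced : ∀ j h → MiddleThird (Σall (List.lookup w j)) (Σpart u h (List.lookup w j))
  balanced = proj₂ partition
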